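{- Let $L$ be a computable (decidable) set of strings over a finite alphabet. Then there is an $\mathrm{ASP^{fs}}$ program $\mathcal{P}$, with a 4-ary predicate $\mathrm{conf}$, a constant $s_i$, a constant for each alphabet symbol, and a constant $\sqcup$, such that for every string $x=x_1\cdots x_n$, the query $\mathcal{Q}_x$ defined as $\mathrm{conf}(s_i,[\,],x_1,[x_2,\dots,x_n])$ if $n>0$ and as $\mathrm{conf}(s_i,[\,],\sqcup,[\,])$ if $n=0$ is finitely recursive on $\mathcal{P}$, and $\mathcal{P}$ cautiously entails $\mathcal{Q}_x$ iff $\mathcal{P}$ bravely entails $\mathcal{Q}_x$ iff $x\in L$.
   Context: Terms are variables or functional terms $f(t_1,\dots,t_k)$; lists are terms built from the constant $[\,]$ and a binary function symbol, with $[h|t]$ denoting the list with head $h$ and tail $t$ and $[a_1,\dots,a_k]$ the usual abbreviation. A rule $r$: $a_1 \vee \dots \vee a_n \leftarrow b_1,\dots,b_j,\mathrm{not}\,b_{j+1},\dots,\mathrm{not}\,b_m$; $H(r)$, $B^+(r)$, $B^-(r)$ are head, positive body, negative body atoms, $\mathrm{atoms}(r)$ their union. A program is a finite set of rules; an $\mathrm{ASP^{fs}}$ program is a stratified one (no cycle of predicate dependencies through negation), disjunction and function symbols allowed. $\mathrm{Ground}(\mathcal{P})$ is the set of ground instances over the ground terms of $\mathcal{P}$'s function symbols; stable models are the subset-minimal models $M$ of the reduct $\mathrm{Ground}(\mathcal{P})^M$ (delete ground rules with $B^-\cap M\neq\emptyset$, drop negative literals). A query is a ground atom; cautious (brave)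 entailment: it is in every (some) stable model. Relevant atoms for $\mathcal{Q}$: $\mathcal{Q}$ and all atoms of $\mathrm{atoms}(r_g)$, $r_g\in\mathrm{Ground}(\mathcal{P})$, with a relevant head atom; $\mathcal{Q}$ is finitely recursive on $\mathcal{P}$ if finitely many ground atoms are relevant. A set $L$ is computable if some deterministic Turing machine halts on every input and accepts exactly the strings in $L$. -}

module Defs where

open import Data.Nat using (ℕ; zero; suc; _+_)
open import Data.Fin using (Fin; toℕ; _≟_)
open import Data.Bool using (Bool; true; false; _∨_)
open import Data.List using (List; []; _∷_; _++_; map; length; concatMap)
open import Data.List.Membership.Propositional using (_∈_)
open import Data.List.Relation.Unary.All using (All)
open import Data.List.Relation.Unary.Any using (Any)
open import Data.Product using (Σ; ∃; _×_; _,_)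
open import Data.Sum using (_⊎_)
open import Relation.Nullary using (¬_)
open import Relation.Nullary.Decidable using (⌊_⌋)
open import Relation.Binary.PropositionalEquality using (_≡_; _≢_)
open import Relation.Binary.Construct.Closure.ReflexiveTransitive using (Star)
open import Function.Bundles using (_⇔_)

-- A function (resp. predicate) symbol is identified by its name (a ℕ)
-- together with its arity (the number of arguments), as in Prolog f/n.

data Term : Set where
  var : ℕ → Term
  fn  : ℕ → List Term → Term

data Atom : Set where
  atom : ℕ → List Term → Atom

predOf : Atom → ℕ × ℕ
predOf (atom p ts) = p , length ts

-- rule  a₁ ∨ … ∨ aₙ ← b₁,…,bⱼ, not bⱼ₊₁, …, not bₘ
record Rule : Set where
  constructor rule
  field
    head : List Atom
    pos  : List Atom
    neg  : List Atom
open Rule public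

atomsR : Rule → List Atom
atomsR r = head r ++ pos r ++ neg r

Program : Set
Program = List Rule

mutual
  substT : (ℕ → Term) → Term → Term
  substT σ (var v)   = σ v
  substT σ (fn f ts) = fn f (substTs σ ts)

  substTs : (ℕ → Term) → List Term → List Term
  substTs σ []       = []
  substTs σ (t ∷ ts) = substT σ t ∷ substTs σ ts

substA : (ℕ → Term) → Atom → Atom
substA σ (atom p ts) = atom p (substTs σ ts)

substR : (ℕ → Term) → Rule → Rule
substR σ r = rule (map (substA σ) (head r)) (map (substA σ) (pos r)) (map (substA σ) (neg r))

mutual
  symsT : Term → List (ℕ × ℕ)
  symsT (var _)   = []
  symsT (fn f ts) = (f , length ts) ∷ symsTs ts

  symsTs : List Term → List (ℕ × ℕ)
  symsTs []       = []
  symsTs (t ∷ ts) = symsT t ++ symsTs ts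

symsA : Atom → List (ℕ × ℕ)
symsA (atom _ ts) = symsTs ts

symsP : Program → List (ℕ × ℕ)
symsP P = concatMap (λ r → concatMap symsA (atomsR r)) P

data InHU (S : List (ℕ × ℕ)) : Term → Set where
  fn : ∀ {f ts} → (f , length ts) ∈ S → All (InHU S) ts → InHU S (fn f ts)

GroundSubst : Program → (ℕ → Term) → Set
GroundSubst P σ = ∀ v → InHU (symsP P) (σ v)

data GroundInst (P : Program) : Rule → Set where
  inst : ∀ {r} (σ : ℕ → Term) → r ∈ P → GroundSubst P σ → GroundInst P (substR σ r)

Interp : Set₁
Interp = Atom → Set

-- N is a model of the reduct Ground(P)^M
ModelOfReduct : Program → Interp → Interp → Set
ModelOfReduct P M N =
  ∀ r → GroundInst P r → All (λ a → ¬ M a) (neg r) → All N (pos r) → Any N (head r)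

StableModel : Program → Interp → Set₁
StableModel P M =
  ModelOfReduct P M M ×
  (∀ (N : Interp) → (∀ a → N a → M a) → ModelOfReduct P M N → ∀ a → M a → N a)

CautiouslyEntails : Program → Atom → Set₁
CautiouslyEntails P Q = ∀ (M : Interp) → StableModel P M → M Q

BravelyEntails : Program → Atom → Set₁
BravelyEntails P Q = Σ Interp λ M → StableModel P M × M Q

data Relevant (P : Program) (Q : Atom) : Atom → Set where
  query : Relevant P Q Q
  step  : ∀ {r a b} → GroundInst P r → a ∈ head r → Relevant P Q a →
          b ∈ atomsR r → Relevant P Q b

FinitelyRecursive : Program → Atom → Set
FinitelyRecursive P Q = Σ (List Atom) λ xs → ∀ a → Relevant P Q a → a ∈ xs

Dep : Program → ℕ × ℕ → ℕ × ℕ → Set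
Dep P p q = Σ Rule λ r → r ∈ P × Σ Atom λ h → h ∈ head r × predOf h ≡ p ×
            Σ Atom λ b → b ∈ (pos r ++ neg r) × predOf b ≡ q

NegDep : Program → ℕ × ℕ → ℕ × ℕ → Set
NegDep P p q = Σ Rule λ r → r ∈ P × Σ Atom λ h → h ∈ head r × predOf h ≡ p ×
               Σ Atom λ b → b ∈ neg r × predOf b ≡ q

Stratified : Program → Set
Stratified P = ∀ p q → NegDep P p q → ¬ Star (Dep P) q p

-- Deterministic Turing machines (two-way infinite tape), input alphabet Fin k

data Sym (k e : ℕ) : Set where
  inp   : Fin k → Sym k e
  blank : Sym k e
  aux   : Fin e → Sym k e

data Move : Set where
  L R : Move

record TM (k : ℕ) : Set where
  field
    nQ nAux       : ℕ
    start acc rej : Fin nQ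
    acc≢rej       : acc ≢ rej
    δ             : Fin nQ → Sym k nAux → Fin nQ × Sym k nAux × Move

module _ {k : ℕ} (M : TM k) where
  open TM M

  record Config : Set where
    constructor cfg
    field
      state : Fin nQ
      left  : List (Sym k nAux)   -- cells left of the head, nearest first
      cur   : Sym k nAux
      right : List (Sym k nAux)   -- cells right of the head, nearest first
  open Config public

  halted : Fin nQ → Bool
  halted q = ⌊ q ≟ acc ⌋ ∨ ⌊ q ≟ rej ⌋

  move : Fin nQ → Sym k nAux → Move → List (Sym k nAux) → List (Sym k nAux) → Config
  move q w L []       rs = cfg q [] blank (w ∷ rs)
  move q w L (l ∷ ls) rs = cfg q ls l (w ∷ rs)
  move q w R ls []       = cfg q (w ∷ ls) blank []
  move q w R ls (r ∷ rs) = cfg q (w ∷ ls) r rs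

  stepTM : Config → Config
  stepTM c with halted (state c)
  ... | true  = c
  ... | false with δ (state c) (cur c)
  ...   | q , w , m = move q w m (left c) (right c)

  run : ℕ → Config → Config
  run zero    c = c
  run (suc n) c = run n (stepTM c)

  initCfg : List (Fin k) → Config
  initCfg []       = cfg start [] blank []
  initCfg (a ∷ as) = cfg start [] (inp a) (map inp as)

  HaltsOn : List (Fin k) → Set
  HaltsOn x = Σ ℕ λ n → state (run n (initCfg x)) ≡ acc ⊎ state (run n (initCfg x)) ≡ rej

  AcceptsTM : List (Fin k) → Set
  AcceptsTM x = Σ ℕ λ n → state (run n (initCfg x)) ≡ acc

Computable : {k : ℕ} → (List (Fin k) → Set) → Set
Computable {k} Lang = Σ (TM k) λ M → (∀ x → HaltsOn M x) × (∀ x → AcceptsTM M x ⇔ Lang x)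

-- Fixed symbols used by the queries
-- conf/4 is predicate name 0; [] is the constant 0, [h|t] is the binary symbol 1;
-- s_i is constant 2, ⊔ is constant 3, alphabet symbol a is constant 4 + a.

confP : ℕ
confP = 0

nilT : Term
nilT = fn 0 []

consT : Term → Term → Term
consT h t = fn 1 (h ∷ t ∷ [])

siT : Term
siT = fn 2 []

blankT : Term
blankT = fn 3 []

symT : {k : ℕ} → Fin k → Term
symT a = fn (4 + toℕ a) []

listT : List Term → Term
listT []       = nilT
listT (t ∷ ts) = consT t (listT ts)

queryAtom : {k : ℕ} → List (Fin k) → Atom
queryAtom []       = atom confP (siT ∷ nilT ∷ blankT ∷ nilT ∷ [])
queryAtom (a ∷ as) = atom confP (siT ∷ nilT ∷ symT a ∷ listT (map symT as) ∷ [])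

-- The machine is simulated backwards by a negation-free Horn program over conf/4: a fact makes
-- every accepting configuration true, and for every transition out of a non-halting state a
-- rule derives a configuration from its successor.  Without negation the unique stable model
-- is the least model, so cautious and brave entailment both mean derivability, and conf(c) is
-- derivable exactly when the run from c accepts.  The atoms relevant to conf(c) are the
-- configurations of that run, finitely many because the machine halts.

module Submission where

open import Defs
open import Data.Nat using (ℕ; zero; suc)
open import Data.Nat.Properties using (+-cancelˡ-≡)
open import Data.Fin using (Fin; toℕ; _≟_)
open import Data.Fin.Properties using (toℕ-injective)
open import Data.Bool using (true; false; if_then_else_)
open import Data.Bool.Properties using (∨-zeroʳ)
open import Data.List using (List; []; _∷_; _++_; map; concatMap; allFin; cartesianProduct)
open import Data.List.Properties using (map-∘)
open import Data.List.Membership.Propositional using (_∈_; lose)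
open import Data.List.Membership.Propositional.Properties
  using (∈-map⁺; ∈-map⁻; ∈-++⁺ˡ; ∈-++⁺ʳ; ∈-++⁻; ∈-concatMap⁺; ∈-concatMap⁻; ∈-cartesianProduct⁺; ∈-allFin)
open import Data.List.Relation.Unary.All using (All; []; _∷_)
open import Data.List.Relation.Unary.Any using (here; there; satisfied)
open import Data.List.Relation.Unary.Any.Properties using (singleton⁻)
open import Data.Product using (Σ; ∃; ∃₂; _×_; _,_; proj₁; proj₂)
open import Data.Sum using (_⊎_; inj₁; inj₂)
open import Relation.Nullary using (yes; no)
open import Relation.Nullary.Decidable using (dec-true; isYes≗does)
open import Relation.Binary.PropositionalEquality using (_≡_; refl; sym; trans; cong; cong₂; subst)
open import Function.Bundles using (_⇔_; mk⇔)
open import Function.Construct.Composition using (_⇔-∘_)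

consT-injective : ∀ {t u t′ u′} → consT t u ≡ consT t′ u′ → t ≡ t′ × u ≡ u′
consT-injective refl = refl , refl

fn-injective : ∀ {f g} {ts us : List Term} → fn f ts ≡ fn g us → f ≡ g × ts ≡ us
fn-injective refl = refl , refl

symsTs-∈ : ∀ {x t ts} → t ∈ ts → x ∈ symsT t → x ∈ symsTs ts
symsTs-∈ {ts = t ∷ _}  (here refl) x∈ = ∈-++⁺ˡ x∈
symsTs-∈ {ts = t ∷ _}  (there t∈)  x∈ = ∈-++⁺ʳ (symsT t) (symsTs-∈ t∈ x∈)

Clause : Set
Clause = Atom × List Atom

hornRule : Clause → Rule
hornRule (h , b) = rule (h ∷ []) b []

horn : List Clause → Program
horn = map hornRule

horn-stratified : ∀ H → Stratified (horn H)
horn-stratified H p q (r , r∈ , _ , _ , _ , _ , b∈neg , _) with ∈-map⁻ hornRule r∈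
horn-stratified H p q (r , r∈ , _ , _ , _ , _ , () , _) | _ , _ , refl

module HornProgram (H : List Clause) where

  -- The substitution ranges over the Herbrand universe of the whole program H, not just of C.
  GroundInstanceIn : List Clause → Atom → List Atom → Set
  GroundInstanceIn C h b =
    Σ Clause λ cl → cl ∈ C × Σ (ℕ → Term) λ σ → GroundSubst (horn H) σ ×
      substA σ (proj₁ cl) ≡ h × map (substA σ) (proj₂ cl) ≡ b

  GroundInstance : Atom → List Atom → Set
  GroundInstance = GroundInstanceIn H

  groundInstanceIn-mono : ∀ {C D h b} → (∀ {cl} → cl ∈ C → cl ∈ D) →
                          GroundInstanceIn C h b → GroundInstanceIn D h b
  groundInstanceIn-mono C⊆D (cl , cl∈ , rest) = cl , C⊆D cl∈ , rest

  groundInstance⇒groundInst : ∀ {h b} → GroundInstance h b → GroundInst (horn H) (hornRule (h , b))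
  groundInstance⇒groundInst (_ , cl∈ , σ , ground , refl , refl) = inst σ (∈-map⁺ hornRule cl∈) ground

  data HornInst : Rule → Set where
    hornInst : ∀ {h b} → GroundInstance h b → HornInst (hornRule (h , b))

  groundInst⇒hornInst : ∀ {r} → GroundInst (horn H) r → HornInst r
  groundInst⇒hornInst (inst σ r∈ ground) with ∈-map⁻ hornRule r∈
  ... | cl , cl∈ , refl = hornInst (cl , cl∈ , σ , ground , refl , refl)

  data Derivable : Atom → Set where
    derive : ∀ {h b} → GroundInstance h b → All Derivable b → Derivable h

  module _ {P : Atom → Set} (closed : ∀ {h b} → GroundInstance h b → All P b → P h) where

    mutual
      derivable-ind : ∀ {a} → Derivable a → P a
      derivable-ind (derive i ds) = closed i (all-derivable-ind ds)

      all-derivable-ind : ∀ {as} → All Derivable as → All P as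
      all-derivable-ind []       = []
      all-derivable-ind (d ∷ ds) = derivable-ind d ∷ all-derivable-ind ds

  derivable-model : ∀ M → ModelOfReduct (horn H) M Derivable
  derivable-model M r r-inst _ body with groundInst⇒hornInst r-inst
  ... | hornInst i = here (derive i body)

  derivable-⊆-model : ∀ {M N} → ModelOfReduct (horn H) M N → ∀ {a} → Derivable a → N a
  derivable-⊆-model model =
    derivable-ind λ i Nb → singleton⁻ (model _ (groundInstance⇒groundInst i) [] Nb)

  derivable-stable : StableModel (horn H) Derivable
  derivable-stable = derivable-model Derivable , λ _ _ model _ → derivable-⊆-model model

  stable⇒derivable : ∀ {M} → StableModel (horn H) M → ∀ {a} → M a → Derivable a
  stable⇒derivable (model , minimal) =
    minimal Derivable (λ _ → derivable-⊆-model model) (derivable-model _) _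

  cautious⇔brave : ∀ Q → CautiouslyEntails (horn H) Q ⇔ BravelyEntails (horn H) Q
  cautious⇔brave Q = mk⇔
    (λ cautious → Derivable , derivable-stable , cautious Derivable derivable-stable)
    (λ (_ , stable , MQ) _ stable′ → derivable-⊆-model (proj₁ stable′) (stable⇒derivable stable MQ))

  brave⇔derivable : ∀ Q → BravelyEntails (horn H) Q ⇔ Derivable Q
  brave⇔derivable Q = mk⇔
    (λ (_ , stable , MQ) → stable⇒derivable stable MQ)
    (λ d → Derivable , derivable-stable , d)

  module _ {Q} {P : Atom → Set} (PQ : P Q)
           (closed : ∀ {h b a} → GroundInstance h b → P h → a ∈ b → P a) where

    relevant-ind : ∀ {a} → Relevant (horn H) Q a → P a
    relevant-ind query = PQ
    relevant-ind (step r-inst a∈head rel b∈atoms) with groundInst⇒hornInst r-inst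
    relevant-ind (step _ (here refl) rel (here refl))   | hornInst _ = relevant-ind rel
    relevant-ind (step _ (here refl) rel (there b∈body)) | hornInst {b = b} i with ∈-++⁻ b b∈body
    ... | inj₁ b∈ = closed i (relevant-ind rel) b∈

module _ {k : ℕ} (M : TM k) where
  open TM M

  applyMove : Fin nQ × Sym k nAux × Move → List (Sym k nAux) → List (Sym k nAux) → Config M
  applyMove (q , w , m) = move M q w m

  stepTM-running : ∀ c → halted M (state c) ≡ false →
                   stepTM M c ≡ applyMove (δ (state c) (cur c)) (left c) (right c)
  stepTM-running c h rewrite h = refl

  stepTM-halted : ∀ c → halted M (state c) ≡ true → stepTM M c ≡ c
  stepTM-halted c h rewrite h = refl

  halting⇒halted : ∀ {q} → q ≡ acc ⊎ q ≡ rej → halted M q ≡ true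
  halting⇒halted (inj₁ refl) rewrite isYes≗does (acc ≟ acc) | dec-true (acc ≟ acc) refl = refl
  halting⇒halted (inj₂ refl) rewrite isYes≗does (rej ≟ rej) | dec-true (rej ≟ rej) refl = ∨-zeroʳ _

  run-suc : ∀ n c → run M (suc n) c ≡ stepTM M (run M n c)
  run-suc zero    c = refl
  run-suc (suc n) c = run-suc n (stepTM M c)

  Accepts : Config M → Set
  Accepts c = ∃ λ n → state (run M n c) ≡ acc

  trace : ℕ → Config M → List (Config M)
  trace zero    c = c ∷ []
  trace (suc T) c = c ∷ trace T (stepTM M c)

  run-∈-trace : ∀ T c → halted M (state (run M T c)) ≡ true → ∀ n → run M n c ∈ trace T c
  run-∈-trace zero    c h zero    = here refl
  run-∈-trace zero    c h (suc n) rewrite stepTM-halted c h = run-∈-trace zero c h n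
  run-∈-trace (suc T) c h zero    = here refl
  run-∈-trace (suc T) c h (suc n) = there (run-∈-trace T (stepTM M c) h n)

module MachineProgram {k : ℕ} (M : TM k) where
  open TM M

  Symbol : Set
  Symbol = Sym k nAux

  -- The start state is the constant s_i of the queries; the others have arity 1.
  stateT : Fin nQ → Term
  stateT q with q ≟ start
  ... | yes _ = siT
  ... | no _  = fn (toℕ q) (nilT ∷ [])

  symbolT : Symbol → Term
  symbolT (inp a) = symT a
  symbolT blank   = blankT
  symbolT (aux e) = fn (toℕ e) (nilT ∷ [])

  tapeT : List Symbol → Term
  tapeT ss = listT (map symbolT ss)

  confAtom : Term → Term → Term → Term → Atom
  confAtom q l s r = atom confP (q ∷ l ∷ s ∷ r ∷ [])

  encode : Config M → Atom
  encode (cfg q l s r) = confAtom (stateT q) (tapeT l) (symbolT s) (tapeT r)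

  confAtom-injective : ∀ {q l s r q′ l′ s′ r′} → confAtom q l s r ≡ confAtom q′ l′ s′ r′ →
                       q ≡ q′ × l ≡ l′ × s ≡ s′ × r ≡ r′
  confAtom-injective refl = refl , refl , refl , refl

  stateT-injective : ∀ {q q′} → stateT q ≡ stateT q′ → q ≡ q′
  stateT-injective {q} {q′} e with q ≟ start | q′ ≟ start
  ... | yes refl | yes refl = refl
  ... | no _     | no _     = toℕ-injective (proj₁ (fn-injective e))

  symbolT-injective : ∀ {s s′} → symbolT s ≡ symbolT s′ → s ≡ s′
  symbolT-injective {inp a} {inp b} e = cong inp (toℕ-injective (+-cancelˡ-≡ 4 _ _ (proj₁ (fn-injective e))))
  symbolT-injective {blank} {blank} e = refl
  symbolT-injective {aux a} {aux b} e = cong aux (toℕ-injective (proj₁ (fn-injective e)))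

  substT-stateT : ∀ σ q → substT σ (stateT q) ≡ stateT q
  substT-stateT σ q with q ≟ start
  ... | yes _ = refl
  ... | no _  = refl

  substT-symbolT : ∀ σ s → substT σ (symbolT s) ≡ symbolT s
  substT-symbolT σ (inp _) = refl
  substT-symbolT σ blank   = refl
  substT-symbolT σ (aux _) = refl

  stateT-start : stateT start ≡ siT
  stateT-start with start ≟ start
  ... | yes _          = refl
  ... | no start≢start with () ← start≢start refl

  query≡encode : ∀ x → queryAtom x ≡ encode (initCfg M x)
  query≡encode []       = cong (λ q → confAtom q nilT blankT nilT) (sym stateT-start)
  query≡encode (a ∷ as) = cong₂ (λ q t → confAtom q nilT (symT a) (listT t)) (sym stateT-start) (map-∘ as)

  allSymbols : List Symbol
  allSymbols = blank ∷ map inp (allFin k) ++ map aux (allFin nAux)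

  symbol∈allSymbols : ∀ s → s ∈ allSymbols
  symbol∈allSymbols blank   = here refl
  symbol∈allSymbols (inp a) = there (∈-++⁺ˡ (∈-map⁺ inp (∈-allFin a)))
  symbol∈allSymbols (aux e) = there (∈-++⁺ʳ (map inp (allFin k)) (∈-map⁺ aux (∈-allFin e)))

  -- Puts every tape symbol and both list constructors into the Herbrand universe;
  -- predicate 1 occurs nowhere else.
  signatureTerms : List Term
  signatureTerms = consT nilT nilT ∷ map symbolT allSymbols

  signatureFact : Clause
  signatureFact = atom 1 signatureTerms , []

  acceptFact : Clause
  acceptFact = confAtom (stateT acc) (var 0) (var 1) (var 2) , []

  -- var 0 and var 1 are the tape beyond the neighbouring cells on the left and on the right,
  -- var 2 the neighbouring cell the head moves onto.
  moveClauses : Fin nQ → Symbol → Fin nQ × Symbol × Move → List Clause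
  moveClauses q s (q′ , w , L) =
    (confAtom (stateT q) nilT (symbolT s) (var 1) ,
     confAtom (stateT q′) nilT blankT (consT (symbolT w) (var 1)) ∷ []) ∷
    (confAtom (stateT q) (consT (var 2) (var 0)) (symbolT s) (var 1) ,
     confAtom (stateT q′) (var 0) (var 2) (consT (symbolT w) (var 1)) ∷ []) ∷ []
  moveClauses q s (q′ , w , R) =
    (confAtom (stateT q) (var 0) (symbolT s) nilT ,
     confAtom (stateT q′) (consT (symbolT w) (var 0)) blankT nilT ∷ []) ∷
    (confAtom (stateT q) (var 0) (symbolT s) (consT (var 2) (var 1)) ,
     confAtom (stateT q′) (consT (symbolT w) (var 0)) (var 2) (var 1) ∷ []) ∷ []

  transitionClauses : Fin nQ × Symbol → List Clause
  transitionClauses (q , s) = if halted M q then [] else moveClauses q s (δ q s)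

  machineClauses : List Clause
  machineClauses = signatureFact ∷ acceptFact ∷
                   concatMap transitionClauses (cartesianProduct (allFin nQ) allSymbols)

  transitionClauses-running : ∀ q s → halted M q ≡ false → transitionClauses (q , s) ≡ moveClauses q s (δ q s)
  transitionClauses-running q s h rewrite h = refl

  open HornProgram machineClauses public

  moveClause-head : ∀ q s t {cl} → cl ∈ moveClauses q s t →
                    ∃₂ λ l r → proj₁ cl ≡ confAtom (stateT q) l (symbolT s) r
  moveClause-head q s (_ , _ , L) (here refl)         = _ , _ , refl
  moveClause-head q s (_ , _ , L) (there (here refl)) = _ , _ , refl
  moveClause-head q s (_ , _ , R) (here refl)         = _ , _ , refl
  moveClause-head q s (_ , _ , R) (there (here refl)) = _ , _ , refl

  moveClause-matches : ∀ q s t {cl σ c} → cl ∈ moveClauses q s t → substA σ (proj₁ cl) ≡ encode c →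
                       q ≡ state c × s ≡ cur c
  moveClause-matches q s t {σ = σ} cl∈ e with moveClause-head q s t cl∈
  ... | _ , _ , refl with confAtom-injective e
  ... | e₁ , _ , e₃ , _ = stateT-injective (trans (sym (substT-stateT σ q)) e₁) ,
                          symbolT-injective (trans (sym (substT-symbolT σ s)) e₃)

  moveClause-body : ∀ q s t {cl σ c} → cl ∈ moveClauses q s t → substA σ (proj₁ cl) ≡ encode c →
                    map (substA σ) (proj₂ cl) ≡ encode (applyMove M t (left c) (right c)) ∷ []
  moveClause-body q s (q′ , w , L) {σ = σ} {cfg _ [] _ _} (here refl) e with confAtom-injective e
  ... | _ , _ , _ , e₄ rewrite substT-stateT σ q′ | substT-symbolT σ w | e₄ = refl
  moveClause-body q s (q′ , w , L) {c = cfg _ (_ ∷ _) _ _} (here refl) e with confAtom-injective e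
  ... | _ , () , _ , _
  moveClause-body q s (q′ , w , L) {c = cfg _ [] _ _} (there (here refl)) e with confAtom-injective e
  ... | _ , () , _ , _
  moveClause-body q s (q′ , w , L) {σ = σ} {cfg _ (_ ∷ _) _ _} (there (here refl)) e with confAtom-injective e
  ... | _ , e₂ , _ , e₄ with consT-injective e₂
  ... | e₅ , e₆ rewrite substT-stateT σ q′ | substT-symbolT σ w | e₄ | e₅ | e₆ = refl
  moveClause-body q s (q′ , w , R) {σ = σ} {cfg _ _ _ []} (here refl) e with confAtom-injective e
  ... | _ , e₂ , _ , _ rewrite substT-stateT σ q′ | substT-symbolT σ w | e₂ = refl
  moveClause-body q s (q′ , w , R) {c = cfg _ _ _ (_ ∷ _)} (here refl) e with confAtom-injective e
  ... | _ , _ , _ , ()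
  moveClause-body q s (q′ , w , R) {c = cfg _ _ _ []} (there (here refl)) e with confAtom-injective e
  ... | _ , _ , _ , ()
  moveClause-body q s (q′ , w , R) {σ = σ} {cfg _ _ _ (_ ∷ _)} (there (here refl)) e with confAtom-injective e
  ... | _ , e₂ , _ , e₄ with consT-injective e₄
  ... | e₅ , e₆ rewrite substT-stateT σ q′ | substT-symbolT σ w | e₂ | e₅ | e₆ = refl

  transitionClause-body : ∀ p {cl σ c} → cl ∈ transitionClauses p → substA σ (proj₁ cl) ≡ encode c →
                          map (substA σ) (proj₂ cl) ≡ encode (stepTM M c) ∷ []
  transitionClause-body (q , s) cl∈ e with halted M q in h
  transitionClause-body (q , s) ()  e | true
  transitionClause-body (q , s) {c = c} cl∈ e | false with moveClause-matches q s (δ q s) cl∈ e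
  ... | refl , refl rewrite stepTM-running M c h = moveClause-body q s (δ q s) cl∈ e

  groundInstance-body : ∀ {c b} → GroundInstance (encode c) b →
                        (state c ≡ acc × b ≡ []) ⊎ b ≡ encode (stepTM M c) ∷ []
  groundInstance-body (_ , here refl , _ , _ , () , _)
  groundInstance-body (_ , there (here refl) , σ , _ , e , refl) with confAtom-injective e
  ... | e₁ , _ = inj₁ (sym (stateT-injective (trans (sym (substT-stateT σ acc)) e₁)) , refl)
  groundInstance-body (_ , there (there cl∈) , σ , _ , e , refl)
    with satisfied (∈-concatMap⁻ transitionClauses {xs = cartesianProduct (allFin nQ) allSymbols} cl∈)
  ... | p , cl∈p = inj₂ (transitionClause-body p cl∈p e)

  GroundTerm : Term → Set
  GroundTerm = InHU (symsP (horn machineClauses))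

  signature-syms : ∀ {t x} → t ∈ signatureTerms → x ∈ symsT t → x ∈ symsP (horn machineClauses)
  signature-syms t∈ x∈ = ∈-++⁺ˡ (∈-++⁺ˡ (symsTs-∈ {ts = signatureTerms} t∈ x∈))

  nilT-ground : GroundTerm nilT
  nilT-ground = fn (signature-syms (here refl) (there (here refl))) []

  consT-ground : ∀ {t u} → GroundTerm t → GroundTerm u → GroundTerm (consT t u)
  consT-ground t u = fn (signature-syms (here refl) (here refl)) (t ∷ u ∷ [])

  symbolT-syms : ∀ s {x} → x ∈ symsT (symbolT s) → x ∈ symsP (horn machineClauses)
  symbolT-syms s x∈ = signature-syms (there (∈-map⁺ symbolT (symbol∈allSymbols s))) x∈

  symbolT-ground : ∀ s → GroundTerm (symbolT s)
  symbolT-ground (inp a) = fn (symbolT-syms (inp a) (here refl)) []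
  symbolT-ground blank   = fn (symbolT-syms blank (here refl)) []
  symbolT-ground (aux e) = fn (symbolT-syms (aux e) (here refl)) (nilT-ground ∷ [])

  tapeT-ground : ∀ ss → GroundTerm (tapeT ss)
  tapeT-ground []       = nilT-ground
  tapeT-ground (s ∷ ss) = consT-ground (symbolT-ground s) (tapeT-ground ss)

  subst₃ : Term → Term → Term → ℕ → Term
  subst₃ a b d 0 = a
  subst₃ a b d 1 = b
  subst₃ a b d 2 = d
  subst₃ a b d (suc (suc (suc _))) = nilT

  subst₃-ground : ∀ {a b d} → GroundTerm a → GroundTerm b → GroundTerm d →
                  GroundSubst (horn machineClauses) (subst₃ a b d)
  subst₃-ground a b d 0 = a
  subst₃-ground a b d 1 = b
  subst₃-ground a b d 2 = d
  subst₃-ground a b d (suc (suc (suc _))) = nilT-ground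

  acceptFact-instance : ∀ c → state c ≡ acc → GroundInstance (encode c) []
  acceptFact-instance (cfg _ l s r) refl =
    acceptFact , there (here refl) ,
    subst₃ (tapeT l) (symbolT s) (tapeT r) , subst₃-ground (tapeT-ground l) (symbolT-ground s) (tapeT-ground r) ,
    cong (λ t → confAtom t (tapeT l) (symbolT s) (tapeT r)) (substT-stateT _ acc) , refl

  moveClause-instance : ∀ q s t l r →
    GroundInstanceIn (moveClauses q s t) (encode (cfg q l s r)) (encode (applyMove M t l r) ∷ [])
  moveClause-instance q s (q′ , w , L) [] r =
    _ , here refl , subst₃ nilT (tapeT r) nilT , subst₃-ground nilT-ground (tapeT-ground r) nilT-ground ,
    cong₂ (λ a b → confAtom a nilT b (tapeT r)) (substT-stateT _ q) (substT-symbolT _ s) ,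
    cong₂ (λ a b → confAtom a nilT blankT (consT b (tapeT r)) ∷ []) (substT-stateT _ q′) (substT-symbolT _ w)
  moveClause-instance q s (q′ , w , L) (x ∷ l) r =
    _ , there (here refl) , subst₃ (tapeT l) (tapeT r) (symbolT x) ,
    subst₃-ground (tapeT-ground l) (tapeT-ground r) (symbolT-ground x) ,
    cong₂ (λ a b → confAtom a (tapeT (x ∷ l)) b (tapeT r)) (substT-stateT _ q) (substT-symbolT _ s) ,
    cong₂ (λ a b → confAtom a (tapeT l) (symbolT x) (consT b (tapeT r)) ∷ []) (substT-stateT _ q′) (substT-symbolT _ w)
  moveClause-instance q s (q′ , w , R) l [] =
    _ , here refl , subst₃ (tapeT l) nilT nilT , subst₃-ground (tapeT-ground l) nilT-ground nilT-ground ,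
    cong₂ (λ a b → confAtom a (tapeT l) b nilT) (substT-stateT _ q) (substT-symbolT _ s) ,
    cong₂ (λ a b → confAtom a (consT b (tapeT l)) blankT nilT ∷ []) (substT-stateT _ q′) (substT-symbolT _ w)
  moveClause-instance q s (q′ , w , R) l (x ∷ r) =
    _ , there (here refl) , subst₃ (tapeT l) (tapeT r) (symbolT x) ,
    subst₃-ground (tapeT-ground l) (tapeT-ground r) (symbolT-ground x) ,
    cong₂ (λ a b → confAtom a (tapeT l) b (tapeT (x ∷ r))) (substT-stateT _ q) (substT-symbolT _ s) ,
    cong₂ (λ a b → confAtom a (consT b (tapeT l)) (symbolT x) (tapeT r) ∷ []) (substT-stateT _ q′) (substT-symbolT _ w)

  step-instance : ∀ c → halted M (state c) ≡ false → GroundInstance (encode c) (encode (stepTM M c) ∷ [])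
  step-instance c@(cfg q l s r) h rewrite stepTM-running M c h =
    groundInstanceIn-mono transition∈ (moveClause-instance q s (δ q s) l r)
    where
    transition∈ : ∀ {cl} → cl ∈ moveClauses q s (δ q s) → cl ∈ machineClauses
    transition∈ cl∈ = there (there (∈-concatMap⁺ transitionClauses
      (lose (∈-cartesianProduct⁺ (∈-allFin q) (symbol∈allSymbols s))
            (subst (_ ∈_) (sym (transitionClauses-running q s h)) cl∈))))

  derivable⇒accepts : ∀ c → Derivable (encode c) → Accepts M c
  derivable⇒accepts c d = derivable-ind closed d c refl
    where
    AcceptsIfEncodes : Atom → Set
    AcceptsIfEncodes a = ∀ c → a ≡ encode c → Accepts M c

    closed : ∀ {h b} → GroundInstance h b → All AcceptsIfEncodes b → AcceptsIfEncodes h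
    closed i IH c refl with groundInstance-body i
    closed i IH        c refl | inj₁ (accepting , _) = 0 , accepting
    closed i (IH ∷ []) c refl | inj₂ refl with IH (stepTM M c) refl
    ... | n , accepting = suc n , accepting

  accepts⇒derivable : ∀ n c → state (run M n c) ≡ acc → Derivable (encode c)
  accepts⇒derivable zero    c accepting = derive (acceptFact-instance c accepting) []
  accepts⇒derivable (suc n) c accepting = by-halting (halted M (state c)) refl
    where
    by-halting : ∀ b → halted M (state c) ≡ b → Derivable (encode c)
    by-halting true  h = accepts⇒derivable n c (subst (λ c′ → state (run M n c′) ≡ acc) (stepTM-halted M c h) accepting)
    by-halting false h = derive (step-instance c h) (accepts⇒derivable n (stepTM M c) accepting ∷ [])

  derivable-query⇔accepts : ∀ x → Derivable (queryAtom x) ⇔ AcceptsTM M x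
  derivable-query⇔accepts x = mk⇔
    (λ d → derivable⇒accepts (initCfg M x) (subst Derivable (query≡encode x) d))
    (λ (n , accepting) → subst Derivable (sym (query≡encode x)) (accepts⇒derivable n (initCfg M x) accepting))

  relevant⇒on-run : ∀ {c a} → Relevant (horn machineClauses) (encode c) a → ∃ λ n → a ≡ encode (run M n c)
  relevant⇒on-run {c} = relevant-ind (0 , refl) closed
    where
    OnRun : Atom → Set
    OnRun a = ∃ λ n → a ≡ encode (run M n c)

    closed : ∀ {h b a} → GroundInstance h b → OnRun h → a ∈ b → OnRun a
    closed i (n , refl) a∈ with groundInstance-body i
    closed i (n , refl) ()          | inj₁ (_ , refl)
    closed i (n , refl) (here refl) | inj₂ refl = suc n , cong encode (sym (run-suc M n c))

  halts⇒finitelyRecursive : ∀ x → HaltsOn M x → FinitelyRecursive (horn machineClauses) (queryAtom x)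
  halts⇒finitelyRecursive x (T , stopped) rewrite query≡encode x =
    map encode (trace M T (initCfg M x)) , λ _ rel → on-trace (relevant⇒on-run rel)
    where
    on-trace : ∀ {a} → (∃ λ n → a ≡ encode (run M n (initCfg M x))) → a ∈ map encode (trace M T (initCfg M x))
    on-trace (n , refl) = ∈-map⁺ encode (run-∈-trace M T (initCfg M x) (halting⇒halted M stopped) n)

theorem7 : (k : ℕ) (Lang : List (Fin k) → Set) → Computable Lang →
    Σ Program λ P → Stratified P ×
      (∀ (x : List (Fin k)) →
        FinitelyRecursive P (queryAtom x) ×
        (CautiouslyEntails P (queryAtom x) ⇔ BravelyEntails P (queryAtom x)) ×
        (BravelyEntails P (queryAtom x) ⇔ Lang x))
theorem7 k Lang (M , halts , accepts⇔Lang) =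
  horn machineClauses , horn-stratified machineClauses ,
  λ x → halts⇒finitelyRecursive x (halts x) ,
        cautious⇔brave (queryAtom x) ,
        accepts⇔Lang x ⇔-∘ (derivable-query⇔accepts x ⇔-∘ brave⇔derivable (queryAtom x))
  where open MachineProgram M
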